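{- For any two different classes $\mathcal{C}\neq\mathcal{C}'$ in $\{\mathrm{Horn},\mathrm{dHorn},\mathrm{Krom}\}$, the parameters $\mathrm{size}_{\mathcal{C}\cup\mathcal{C}'}$ and $\mathrm{depth}_{\mathcal{C}}$ are domination orthogonal.
   Context: A clause is a finite set of literals with no complementary pair; a CNF formula is a finite set of clauses. For a partial assignment $\tau$, $F[\tau]$ is obtained by deleting clauses containing a true literal and deleting false literals from the remaining clauses. $\mathrm{Conn}(F)$ is the set of connected components of $F$ with respect to its incidence graph. Horn: every clause has at most one positive literal; dHorn: at most one negative literal; Krom: at most two literals. $\mathcal{C}\cup\mathcal{C}'$ is the union of the two classes. $\mathrm{depth}_{\mathcal{C}}(F)$ is $0$ if $F\in\mathcal{C}$; if $F\notin\mathcal{C}$ and $F$ is connected it is $1+\min_{x\in\mathit{var}(F)}\max_{\epsilon\in\{0,1\}}\mathrm{depth}_{\mathcal{C}}(F[x=\epsilon])$; otherwise it is $\max_{F'\in\mathrm{Conn}(F)}\mathrm{depth}_{\mathcal{C}}(F')$. For a class $\mathcal{D}$, $\mathrm{size}_{\mathcal{D}}(F)$ is the minimum size of a set $B\subseteq\mathit{var}(F)$ with $F[\tau]\in\mathcal{D}$ for all $\tau:B\to\{0,1\}$. For integer-valued parameters $p,q$: $p$ dominates $q$ if every class of formulas on which $q$ is bounded also has $p$ bounded; $p,q$ are domination orthogonal if neither dominates the other. -}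

module Defs where

open import Data.Nat using (ℕ; zero; suc; _≤_; _≟_)
open import Data.Bool using (Bool; true; false; not; _∧_; _∨_)
open import Data.Bool.Properties using () renaming (_≟_ to _≟ᵇ_)
open import Data.Product using (Σ; ∃; ∃-syntax; _×_; _,_; proj₁; proj₂)
open import Data.Sum using (_⊎_)
open import Data.List using (List; []; _∷_; length; filter; map)
open import Data.List.Membership.Propositional using (_∈_; _∉_)
open import Data.List.Relation.Unary.All using (All)
open import Data.List.Relation.Unary.Any using (Any)
open import Data.List.Relation.Unary.Unique.Propositional using (Unique)
open import Relation.Binary.PropositionalEquality using (_≡_; _≢_)
open import Relation.Nullary using (¬_; Dec; yes; no)
open import Relation.Nullary.Decidable using (⌊_⌋)
open import Data.List.Membership.DecPropositional (_≟_) using (_∈?_)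
open import Function.Bundles using (_⇔_)
open import Data.Empty using (⊥)

-- Literals, clauses, formulas
-- A literal is a pair (variable, polarity); (x , true) is the positive
-- literal x, (x , false) the negative literal ¬x.

Var : Set
Var = ℕ

Lit : Set
Lit = Var × Bool

var : Lit → Var
var = proj₁

Clause : Set
Clause = List Lit

CNF : Set
CNF = List Clause

NoComplement : Clause → Set
NoComplement c = ∀ x → (x , true) ∈ c → (x , false) ∈ c → ⊥

-- A well-formed clause is duplicate-free (it is a finite set) and has no
-- complementary pair; a well-formed formula consists of well-formed clauses.
WFClause : Clause → Set
WFClause c = Unique c × NoComplement c

WF : CNF → Set
WF F = All WFClause F

_occursIn_ : Var → Clause → Set
x occursIn c = Any (λ l → var l ≡ x) c

_∈var_ : Var → CNF → Set
x ∈var F = Any (λ c → x occursIn c) F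

-- Partial assignments and restriction F[τ]
-- A partial assignment τ : B → {0,1} is given by its domain B (a list of
-- variables) together with a total function ℕ → Bool whose values outside
-- B are ignored.

inDom : List Var → Var → Bool
inDom B x = ⌊ x ∈? B ⌋

litTrue : List Var → (Var → Bool) → Lit → Bool
litTrue B τ (x , b) = inDom B x ∧ ⌊ τ x ≟ᵇ b ⌋

litFalse : List Var → (Var → Bool) → Lit → Bool
litFalse B τ (x , b) = inDom B x ∧ not ⌊ τ x ≟ᵇ b ⌋

anyB : {A : Set} → (A → Bool) → List A → Bool
anyB p []       = false
anyB p (a ∷ as) = p a ∨ anyB p as

-- F[τ]: delete clauses containing a true literal, delete false literals
-- from the remaining ones.
restrict : List Var → (Var → Bool) → CNF → CNF
restrict B τ F =
  map (filter (λ l → not (litFalse B τ l) ≟ᵇ true))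
      (filter (λ c → anyB (litTrue B τ) c ≟ᵇ false) F)

assign : Var → Bool → CNF → CNF
assign x ε F = restrict (x ∷ []) (λ _ → ε) F

Share : Clause → Clause → Set
Share c d = ∃[ x ] (x occursIn c × x occursIn d)

-- c and d lie in the same connected component of the incidence graph of F
-- (a path of clauses of F, consecutive ones sharing a variable).
data Linked (F : CNF) : Clause → Clause → Set where
  here : ∀ {c} → c ∈ F → Linked F c c
  step : ∀ {c d e} → Linked F c d → e ∈ F → Share d e → Linked F c e

Connected : CNF → Set
Connected F = ∀ c d → c ∈ F → d ∈ F → Linked F c d

-- F' is (a representation of) a connected component of F: the set of
-- clauses of F reachable from some clause c of F.
IsComponent : CNF → CNF → Set
IsComponent F F' = ∃[ c ] (c ∈ F × (∀ d → (d ∈ F' ⇔ (d ∈ F × Linked F c d))))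

Class : Set₁
Class = CNF → Set

positive : Lit → Bool
positive (_ , b) = b

negative : Lit → Bool
negative (_ , b) = not b

Horn : Class
Horn F = All (λ c → length (filter (λ l → positive l ≟ᵇ true) c) ≤ 1) F

dHorn : Class
dHorn F = All (λ c → length (filter (λ l → negative l ≟ᵇ true) c) ≤ 1) F

Krom : Class
Krom F = All (λ c → length c ≤ 2) F

_∪ᶜ_ : Class → Class → Class
(C ∪ᶜ C') F = C F ⊎ C' F

data BaseClass : Set where
  horn dhorn krom : BaseClass

⟦_⟧ᶜ : BaseClass → Class
⟦ horn ⟧ᶜ  = Horn
⟦ dhorn ⟧ᶜ = dHorn
⟦ krom ⟧ᶜ  = Krom

-- Parameters.  An integer-valued parameter p is represented by the
-- relation  "p(F) ≤ k", i.e.  Param = ℕ → CNF → Set  with  p k F  meaning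
-- p(F) ≤ k.

Param : Set₁
Param = ℕ → CNF → Set

-- depth_C(F) ≤ k, unfolding the recursive definition of depth_C.
data DepthLE (C : Class) : ℕ → CNF → Set where
  inClass : ∀ {k F} → C F → DepthLE C k F
  split   : ∀ {k F} → ¬ C F → Connected F →
            (x : Var) → x ∈var F →
            DepthLE C k (assign x false F) →
            DepthLE C k (assign x true F) →
            DepthLE C (suc k) F
  comps   : ∀ {k F} → ¬ C F → ¬ Connected F →
            (∀ F' → IsComponent F F' → DepthLE C k F') →
            DepthLE C k F

depth : Class → Param
depth C k F = DepthLE C k F

size : Class → Param
size D k F = ∃[ B ] (length B ≤ k × All (λ x → x ∈var F) B
                     × ((τ : Var → Bool) → D (restrict B τ F)))

Bounded : Param → Class → Set
Bounded p 𝒦 = ∃[ k ] (∀ F → WF F → 𝒦 F → p k F)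

Dominates : Param → Param → Set₁
Dominates p q = (𝒦 : Class) → Bounded q 𝒦 → Bounded p 𝒦

DominationOrthogonal : Param → Param → Set₁
DominationOrthogonal p q = ¬ Dominates p q × ¬ Dominates q p

-- Size does not dominate depth: take k + 2 disjoint copies of a clause
-- with two positive and two negative literals, which lies in none of the
-- three classes.  Every component is a single clause of length 4, so the
-- depth is at most 4, but a backdoor must touch a variable of every copy.
--
-- Depth does not dominate size: a family lying in the other class has
-- size 0, while its depth grows without bound.  For Horn (dually dHorn)
-- take all positive 2-clauses on k + 2 variables (these are dHorn and
-- Krom); for Krom take one long positive or negative clause.  The depth
-- lower bounds come from an invariant (a large clique, resp. a long
-- clause) that excludes the class, survives one branch of every split,
-- and survives passing to some connected component.

module Submission where

open import Defs
open import Data.Bool using (Bool; true; false; not)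
open import Data.Bool.Properties using () renaming (_≟_ to _≟ᵇ_)
open import Data.Empty using (⊥-elim)
open import Data.List using (List; []; _∷_; length; filter; map; _++_; downFrom; upTo)
open import Data.List.Properties
  using (filter-all; filter-none; filter-reject; filter-notAll; length-map; length-downFrom; map-∘; map-id)
open import Data.List.Membership.Propositional using (_∈_; _∉_)
open import Data.List.Membership.Propositional.Properties
  using (∈-filter⁺; ∈-filter⁻; ∈-map⁺; ∈-map⁻; ∈-++⁺ˡ; ∈-++⁺ʳ; ∈-downFrom⁺; ∈-downFrom⁻)
open import Data.List.Relation.Binary.Subset.Propositional using (_⊆_)
import Data.List.Relation.Binary.Sublist.Propositional as Sublist
import Data.List.Relation.Binary.Sublist.Propositional.Properties as Sublist
open import Data.List.Relation.Unary.All as All using (All; []; _∷_)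
import Data.List.Relation.Unary.All.Properties as All
open import Data.List.Relation.Unary.Any as Any using (here; there)
open import Data.List.Relation.Unary.AllPairs using ([]; _∷_)
open import Data.List.Relation.Unary.Unique.Propositional using (Unique)
import Data.List.Relation.Unary.Unique.Propositional.Properties as Unique
open import Data.Nat using (ℕ; zero; suc; _+_; _*_; _≤_; _<_; z≤n; s≤s; _≤?_) renaming (_≟_ to _≟ₙ_)
open import Data.Nat.Properties
  using (≤-trans; ≤-reflexive; ≤-pred; n≤1+n; <⇒≢; <⇒≱; ≤∧≢⇒<; <-cmp; 1+n≢n; +-cancelʳ-≡)
open import Data.Nat.Properties using (module ≤-Reasoning)
open import Data.Nat.DivMod using (_/_; +-distrib-/-∣ʳ; m<n⇒m/n≡0; m*n/n≡m)
open import Data.Nat.Divisibility using (divides)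
open import Data.Product using (∃-syntax; _×_; _,_; proj₁; proj₂; map₁)
open import Data.Sum using (_⊎_; inj₁; inj₂)
open import Function.Bundles using (_⇔_; mk⇔; Equivalence)
open import Relation.Binary using (DecidableEquality; Tri; tri<; tri≈; tri>)
open import Relation.Binary.PropositionalEquality
  using (_≡_; _≢_; refl; sym; trans; cong; cong₂; subst; subst₂; module ≡-Reasoning)
open import Relation.Nullary using (¬_; Dec; yes; no; ¬?; contradiction)
open import Relation.Nullary.Decidable using (isYes; isYes≗does; dec-true; dec-false; ¬¬-excluded-middle)
open import Data.List.Membership.DecPropositional _≟ₙ_ using (_∈?_)

module _ {A : Set} (_≟_ : DecidableEquality A) where

  without : A → List A → List A
  without x = filter (λ y → ¬? (y ≟ x))

  ∈-without⁺ : ∀ {x y xs} → y ∈ xs → y ≢ x → y ∈ without x xs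
  ∈-without⁺ {x} = ∈-filter⁺ (λ y → ¬? (y ≟ x))

  ∈-without⁻ : ∀ {x y xs} → y ∈ without x xs → y ∈ xs × y ≢ x
  ∈-without⁻ {x} = ∈-filter⁻ (λ y → ¬? (y ≟ x))

  Unique-without : ∀ {x xs} → Unique xs → Unique (without x xs)
  Unique-without {x} = Unique.filter⁺ (λ y → ¬? (y ≟ x))

  Unique⇒length≤ : ∀ {xs ys} → Unique xs → xs ⊆ ys → length xs ≤ length ys
  Unique⇒length≤ {[]}          _          _     = z≤n
  Unique⇒length≤ {x ∷ xs} {ys} (x∉xs ∷ u) xs⊆ys = begin
    suc (length xs)             ≤⟨ s≤s (Unique⇒length≤ u xs⊆ys-x) ⟩
    suc (length (without x ys)) ≤⟨ filter-notAll (λ y → ¬? (y ≟ x)) ys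
                                     (Any.map (λ x≡y y≢x → y≢x (sym x≡y)) (xs⊆ys (here refl))) ⟩
    length ys                   ∎
    where
    open ≤-Reasoning
    xs⊆ys-x : xs ⊆ without x ys
    xs⊆ys-x y∈xs = ∈-without⁺ (xs⊆ys (there y∈xs)) (λ y≡x → All.lookup x∉xs y∈xs (sym y≡x))

  length≤1+length-without : ∀ x {xs} → Unique xs → length xs ≤ suc (length (without x xs))
  length≤1+length-without x {xs} u = Unique⇒length≤ u xs⊆x∷xs-x
    where
    xs⊆x∷xs-x : xs ⊆ x ∷ without x xs
    xs⊆x∷xs-x {y} y∈xs with y ≟ x
    ... | yes refl = here refl
    ... | no y≢x   = there (∈-without⁺ y∈xs y≢x)

Unique-map⇒injectiveOn : ∀ {A B : Set} {f : A → B} {xs a b} →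
  Unique (map f xs) → a ∈ xs → b ∈ xs → f a ≡ f b → a ≡ b
Unique-map⇒injectiveOn _ (here refl) (here refl) _ = refl
Unique-map⇒injectiveOn {f = f} (fa∉ ∷ _) (here refl) (there b∈) fa≡fb =
  ⊥-elim (All.lookup fa∉ (∈-map⁺ f b∈) fa≡fb)
Unique-map⇒injectiveOn {f = f} (fb∉ ∷ _) (there a∈) (here refl) fa≡fb =
  ⊥-elim (All.lookup fb∉ (∈-map⁺ f a∈) (sym fa≡fb))
Unique-map⇒injectiveOn (_ ∷ u) (there a∈) (there b∈) fa≡fb = Unique-map⇒injectiveOn u a∈ b∈ fa≡fb

pigeonhole : ∀ {n} (L : List ℕ) → length L < n → ¬ (∀ i → i < n → i ∈ L)
pigeonhole {n} L L<n all∈L = <⇒≱ L<n (subst (_≤ length L) (length-downFrom n)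
  (Unique⇒length≤ _≟ₙ_ (Unique.downFrom⁺ n) (λ i∈ → all∈L _ (∈-downFrom⁻ i∈))))

ordered-pair : ∀ {vs : List ℕ} → Unique vs → 2 ≤ length vs → ∃[ i ] ∃[ j ] (i ∈ vs × j ∈ vs × i < j)
ordered-pair {_ ∷ []} _ (s≤s ())
ordered-pair {a ∷ b ∷ _} ((a≢b ∷ _) ∷ _) _ with <-cmp a b
... | tri< a<b _ _ = a , b , here refl , there (here refl) , a<b
... | tri≈ _ a≡b _ = ⊥-elim (a≢b a≡b)
... | tri> _ _ b<a = b , a , there (here refl) , here refl , b<a

¬¬-comprehension : {A : Set} (P : A → Set) (xs : List A) →
  ¬ ¬ (∃[ ys ] (∀ y → y ∈ ys ⇔ (y ∈ xs × P y)))
¬¬-comprehension P []       k = k ([] , λ y → mk⇔ (λ ()) (λ { (() , _) }))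
¬¬-comprehension P (a ∷ xs) k = ¬¬-comprehension P xs λ (ys , ys≈) → ¬¬-excluded-middle λ
  { (yes Pa) → k (a ∷ ys , λ y → mk⇔
      (λ { (here refl)  → here refl , Pa
         ; (there y∈ys) → map₁ there (Equivalence.to (ys≈ y) y∈ys) })
      (λ { (here refl , _)   → here refl
         ; (there y∈xs , Py) → there (Equivalence.from (ys≈ y) (y∈xs , Py)) }))
  ; (no ¬Pa) → k (ys , λ y → mk⇔
      (λ y∈ys → map₁ there (Equivalence.to (ys≈ y) y∈ys))
      (λ { (here refl , Pa)  → ⊥-elim (¬Pa Pa)
         ; (there y∈xs , Py) → Equivalence.from (ys≈ y) (y∈xs , Py) })) }

isYes-true : ∀ {A : Set} (a? : Dec A) → A → isYes a? ≡ true
isYes-true a? a = trans (isYes≗does a?) (dec-true a? a)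

isYes-false : ∀ {A : Set} (a? : Dec A) → ¬ A → isYes a? ≡ false
isYes-false a? ¬a = trans (isYes≗does a?) (dec-false a? ¬a)

inDom-∉ : ∀ {B x} → x ∉ B → inDom B x ≡ false
inDom-∉ {B} {x} = isYes-false (x ∈? B)

-- The two filters in restrict, named so that restricted clauses can be written down.
keep? : (B : List Var) (τ : Var → Bool) (l : Lit) → Dec (not (litFalse B τ l) ≡ true)
keep? B τ l = not (litFalse B τ l) ≟ᵇ true

survives? : (B : List Var) (τ : Var → Bool) (c : Clause) → Dec (anyB (litTrue B τ) c ≡ false)
survives? B τ c = anyB (litTrue B τ) c ≟ᵇ false

anyB-false : ∀ {A : Set} {p : A → Bool} {xs} → All (λ a → p a ≡ false) xs → anyB p xs ≡ false
anyB-false []          = refl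
anyB-false (pa≡f ∷ ps) rewrite pa≡f = anyB-false ps

∈-restrict⁺ : ∀ {B τ F c} → c ∈ F → anyB (litTrue B τ) c ≡ false →
  filter (keep? B τ) c ∈ restrict B τ F
∈-restrict⁺ {B} {τ} c∈F survives = ∈-map⁺ (filter (keep? B τ)) (∈-filter⁺ (survives? B τ) c∈F survives)

∈-restrict⁻ : ∀ {B τ F d} → d ∈ restrict B τ F →
  ∃[ c ] (c ∈ F × anyB (litTrue B τ) c ≡ false × d ≡ filter (keep? B τ) c)
∈-restrict⁻ {B} {τ} {F} d∈ with ∈-map⁻ (filter (keep? B τ)) d∈
... | c , c∈ , d≡ with ∈-filter⁻ (survives? B τ) {xs = F} c∈
...   | c∈F , survives = c , c∈F , survives , d≡

Untouched : List Var → Clause → Set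
Untouched B c = All (λ l → var l ∉ B) c

litTrue-untouched : ∀ {B τ} l → var l ∉ B → litTrue B τ l ≡ false
litTrue-untouched (x , b) x∉B rewrite inDom-∉ x∉B = refl

keep-untouched : ∀ {B τ} l → var l ∉ B → not (litFalse B τ l) ≡ true
keep-untouched (x , b) x∉B rewrite inDom-∉ x∉B = refl

untouched-∈-restrict : ∀ {B τ F c} → c ∈ F → Untouched B c → c ∈ restrict B τ F
untouched-∈-restrict {B} {τ} {F} c∈F u =
  subst (_∈ restrict B τ F) (filter-all (keep? B τ) (All.map (λ {l} → keep-untouched {B} {τ} l) u))
        (∈-restrict⁺ {B} {τ} c∈F (anyB-false (All.map (λ {l} → litTrue-untouched {B} {τ} l) u)))

∉-single : ∀ {x y : Var} → y ≢ x → y ∉ x ∷ []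
∉-single y≢x (here y≡x) = y≢x y≡x

litTrue-assigned : ∀ x ε q → litTrue (x ∷ []) (λ _ → ε) (x , q) ≡ isYes (ε ≟ᵇ q)
litTrue-assigned x ε q rewrite isYes-true (x ∈? x ∷ []) (here refl) = refl

litFalse-assigned : ∀ x ε q → litFalse (x ∷ []) (λ _ → ε) (x , q) ≡ not (isYes (ε ≟ᵇ q))
litFalse-assigned x ε q rewrite isYes-true (x ∈? x ∷ []) (here refl) = refl

litTrue-single-false : ∀ {x ε} l → l ≢ (x , ε) → litTrue (x ∷ []) (λ _ → ε) l ≡ false
litTrue-single-false {x} {ε} (y , q) l≢x,ε = by-cases (y ≟ₙ x)
  where
  by-cases : Dec (y ≡ x) → litTrue (x ∷ []) (λ _ → ε) (y , q) ≡ false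
  by-cases (no y≢x) = litTrue-untouched (y , q) (∉-single y≢x)
  by-cases (yes refl) rewrite litTrue-assigned y ε q with ε ≟ᵇ q
  ... | yes refl = ⊥-elim (l≢x,ε refl)
  ... | no _     = refl

Copies : Clause → CNF → Set
Copies c F = c ∈ F × All (_≡ c) F

restrict-copies : ∀ {B τ F c} → Copies c F → anyB (litTrue B τ) c ≡ false →
  Copies (filter (keep? B τ) c) (restrict B τ F)
restrict-copies {B} {τ} {F} {c} (c∈F , copies) c-survives =
  ∈-restrict⁺ {B} {τ} c∈F c-survives , All.tabulate λ d∈ → shrunk-copy (∈-restrict⁻ {B} {τ} {F} d∈)
  where
  shrunk-copy : ∀ {d} → ∃[ c' ] (c' ∈ F × anyB (litTrue B τ) c' ≡ false × d ≡ filter (keep? B τ) c') →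
                d ≡ filter (keep? B τ) c
  shrunk-copy (c' , c'∈F , _ , refl) = cong (filter (keep? B τ)) (All.lookup copies c'∈F)

restrict-satisfied-copies : ∀ {B τ F c} → All (_≡ c) F → anyB (litTrue B τ) c ≡ true →
  restrict B τ F ≡ []
restrict-satisfied-copies {B} {τ} {c = c} copies c-satisfied =
  cong (map (filter (keep? B τ))) (filter-none (survives? B τ) (All.map (λ { refl → c-unsatisfiable }) copies))
  where
  c-unsatisfiable : ¬ (anyB (litTrue B τ) c ≡ false)
  c-unsatisfiable c-survives = contradiction (trans (sym c-satisfied) c-survives) λ ()

assign-head-satisfied : ∀ a s c → anyB (litTrue (a ∷ []) (λ _ → s)) ((a , s) ∷ c) ≡ true
assign-head-satisfied a s c rewrite litTrue-assigned a s s | isYes-true (s ≟ᵇ s) refl = refl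

module _ {a : Var} {s ε : Bool} {rest : Clause} (ε≢s : ε ≢ s) (rest-untouched : Untouched (a ∷ []) rest)
  where

  assign-head-survives : anyB (litTrue (a ∷ []) (λ _ → ε)) ((a , s) ∷ rest) ≡ false
  assign-head-survives = anyB-false
    (litTrue-single-false (a , s) (λ a,s≡a,ε → ε≢s (sym (cong proj₂ a,s≡a,ε)))
     ∷ All.map (λ {l} → litTrue-untouched {a ∷ []} {λ _ → ε} l) rest-untouched)

  assign-head-shrinks : filter (keep? (a ∷ []) (λ _ → ε)) ((a , s) ∷ rest) ≡ rest
  assign-head-shrinks = trans (filter-reject (keep? (a ∷ []) (λ _ → ε)) head-dropped)
    (filter-all (keep? (a ∷ []) (λ _ → ε))
                (All.map (λ {l} → keep-untouched {a ∷ []} {λ _ → ε} l) rest-untouched))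
    where
    head-dropped : not (litFalse (a ∷ []) (λ _ → ε) (a , s)) ≢ true
    head-dropped rewrite litFalse-assigned a ε s | isYes-false (ε ≟ᵇ s) ε≢s = λ ()

distinctVars⇒WFClause : ∀ {c} → Unique (map var c) → WFClause c
distinctVars⇒WFClause distinct =
  Unique.map⁻ distinct ,
  λ x x,t∈ x,f∈ → contradiction (cong proj₂ (Unique-map⇒injectiveOn distinct x,t∈ x,f∈ refl)) λ ()

ClauseIn : BaseClass → Clause → Set
ClauseIn horn  c = length (filter (λ l → positive l ≟ᵇ true) c) ≤ 1
ClauseIn dhorn c = length (filter (λ l → negative l ≟ᵇ true) c) ≤ 1
ClauseIn krom  c = length c ≤ 2

⟦⟧ᶜ≡All : ∀ C → ⟦ C ⟧ᶜ ≡ All (ClauseIn C)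
⟦⟧ᶜ≡All horn  = refl
⟦⟧ᶜ≡All dhorn = refl
⟦⟧ᶜ≡All krom  = refl

ClauseIn? : ∀ C c → Dec (ClauseIn C c)
ClauseIn? horn  c = _ ≤? 1
ClauseIn? dhorn c = _ ≤? 1
ClauseIn? krom  c = _ ≤? 2

ClauseIn-[] : ∀ C → ClauseIn C []
ClauseIn-[] horn  = z≤n
ClauseIn-[] dhorn = z≤n
ClauseIn-[] krom  = z≤n

ClauseIn-sublist : ∀ C {c d} → d Sublist.⊆ c → ClauseIn C c → ClauseIn C d
ClauseIn-sublist horn  d⊆c = ≤-trans (Sublist.length-mono-≤ (Sublist.filter⁺ _ _ (λ { refl p → p }) d⊆c))
ClauseIn-sublist dhorn d⊆c = ≤-trans (Sublist.length-mono-≤ (Sublist.filter⁺ _ _ (λ { refl p → p }) d⊆c))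
ClauseIn-sublist krom  d⊆c = ≤-trans (Sublist.length-mono-≤ d⊆c)

∉⟦⟧ᶜ : ∀ C {F c} → c ∈ F → ¬ ClauseIn C c → ¬ ⟦ C ⟧ᶜ F
∉⟦⟧ᶜ C {F} c∈F c∉C F∈C = c∉C (All.lookup (subst (λ 𝒞 → 𝒞 F) (⟦⟧ᶜ≡All C) F∈C) c∈F)

restrict-preserves-All : ∀ {P : Clause → Set} → (∀ {c d} → d Sublist.⊆ c → P c → P d) →
  ∀ {B τ F} → All P F → All P (restrict B τ F)
restrict-preserves-All {P} P-sublist {B} {τ} {F} F∈P =
  All.tabulate λ d∈ → P-restricted (∈-restrict⁻ {B} {τ} {F} d∈)
  where
  P-restricted : ∀ {d} → ∃[ c ] (c ∈ F × anyB (litTrue B τ) c ≡ false × d ≡ filter (keep? B τ) c) → P d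
  P-restricted (c , c∈F , _ , refl) = P-sublist (Sublist.filter-⊆ (keep? B τ) c) (All.lookup F∈P c∈F)

restrict-preserves : ∀ C {B τ F} → ⟦ C ⟧ᶜ F → ⟦ C ⟧ᶜ (restrict B τ F)
restrict-preserves C {B} {τ} {F} = subst (λ 𝒞 → 𝒞 F → 𝒞 (restrict B τ F)) (sym (⟦⟧ᶜ≡All C))
                                          (restrict-preserves-All (ClauseIn-sublist C) {B} {τ})

size-zero : ∀ C C' {F} → ⟦ C' ⟧ᶜ F → size (⟦ C ⟧ᶜ ∪ᶜ ⟦ C' ⟧ᶜ) 0 F
size-zero C C' F∈C' = [] , z≤n , [] , λ τ → inj₂ (restrict-preserves C' {[]} {τ} F∈C')

-- Linked F c is not decidable, so the component of c is only known to
-- exist up to double negation; that suffices for the depth lower bounds,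
-- which are refutations.
¬¬-component : ∀ {F c} → c ∈ F →
  ¬ ¬ (∃[ F' ] (IsComponent F F' × (∀ {d} → d ∈ F → Linked F c d → d ∈ F')))
¬¬-component {F} {c} c∈F k = ¬¬-comprehension (Linked F c) F λ (F' , F'≈) →
  k (F' , (c , c∈F , F'≈) , λ d∈F c~d → Equivalence.from (F'≈ _) (d∈F , c~d))

VarDisjoint : CNF → Set
VarDisjoint F = ∀ {c d} → c ∈ F → d ∈ F → Share c d → c ≡ d

Linked⇒≡ : ∀ {F c d} → VarDisjoint F → c ∈ F → Linked F c d → d ≡ c
Linked⇒≡ disjoint c∈F (here _) = refl
Linked⇒≡ disjoint c∈F (step c~d e∈F share) with Linked⇒≡ disjoint c∈F c~d
... | refl = sym (disjoint c∈F e∈F share)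

depth≤length-copies : ∀ {P : Clause → Set} → (∀ c → Dec (P c)) → P [] →
  ∀ c → Unique (map var c) → ∀ {F} → Copies c F → DepthLE (All P) (length c) F
depth≤length-copies P? P[] c _ (_ , copies) with P? c
... | yes Pc = inClass (All.map (λ { refl → Pc }) copies)
depth≤length-copies P? P[] [] _ _ | no ¬P[] = ⊥-elim (¬P[] P[])
depth≤length-copies {P} P? P[] ((a , s) ∷ rest) (a∉rest ∷ distinct) {F} (c∈F , copies) | no ¬Pc =
  split (λ F∈P → ¬Pc (All.lookup F∈P c∈F)) connected a (Any.map (λ { refl → here refl }) c∈F)
        (branch false) (branch true)
  where
  connected : Connected F
  connected d e d∈F e∈F =
    subst₂ (Linked F) (sym (All.lookup copies d∈F)) (sym (All.lookup copies e∈F)) (here c∈F)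
  rest-untouched : Untouched (a ∷ []) rest
  rest-untouched = All.map (λ a≢var → ∉-single (λ var≡a → a≢var (sym var≡a))) (All.map⁻ a∉rest)
  branch : ∀ ε → DepthLE (All P) (length rest) (assign a ε F)
  branch ε with ε ≟ᵇ s
  ... | yes refl = subst (DepthLE (All P) (length rest)) (sym emptied) (inClass [])
    where
    emptied : assign a ε F ≡ []
    emptied = restrict-satisfied-copies {a ∷ []} {λ _ → ε} copies (assign-head-satisfied a ε rest)
  ... | no ε≢s = depth≤length-copies P? P[] rest distinct rest-copies
    where
    rest-copies : Copies rest (assign a ε F)
    rest-copies = subst (λ r → Copies r (assign a ε F)) (assign-head-shrinks ε≢s rest-untouched)
      (restrict-copies {a ∷ []} {λ _ → ε} (c∈F , copies) (assign-head-survives ε≢s rest-untouched))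

module DepthLowerBound (C : Class) (Witness : ℕ → CNF → Set)
  (witness∉C : ∀ {m F} → Witness (suc m) F → ¬ C F)
  (witness-assign : ∀ {m F} → Witness (suc (suc m)) F → ∀ x →
                    ¬ ¬ (∃[ ε ] Witness (suc m) (assign x ε F)))
  (witness-component : ∀ {m F} → Witness (suc m) F →
                       ¬ ¬ (∃[ F' ] (IsComponent F F' × Witness (suc m) F')))
  where

  ¬DepthLE : ∀ {k F} → DepthLE C k F → ¬ Witness (suc k) F
  ¬DepthLE (inClass F∈C) w = witness∉C w F∈C
  ¬DepthLE (split _ _ x _ d₀ d₁) w = witness-assign w x λ where
    (false , w₀) → ¬DepthLE d₀ w₀
    (true  , w₁) → ¬DepthLE d₁ w₁
  ¬DepthLE (comps _ _ d) w =
    witness-component w λ (F' , F'-component , w') → ¬DepthLE (d F' F'-component) w'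

-- A long clause has unbounded Krom-depth

record LongClause (m : ℕ) (c : Clause) : Set where
  field
    noComplement : NoComplement c
    vars         : List Var
    vars-unique  : Unique vars
    vars-many    : 2 + m ≤ length vars
    vars⊆        : vars ⊆ map var c

HasLongClause : ℕ → CNF → Set
HasLongClause m F = ∃[ c ] (c ∈ F × LongClause m c)

longClause∉Krom : ∀ {m F} → HasLongClause (suc m) F → ¬ Krom F
longClause∉Krom (c , c∈F , long) F∈Krom =
  3+m≰2 (≤-trans vars-many (≤-trans (Unique⇒length≤ _≟ₙ_ vars-unique vars⊆)
                              (subst (_≤ 2) (sym (length-map var c)) (All.lookup F∈Krom c∈F))))
  where
  open LongClause long
  3+m≰2 : ∀ {m} → ¬ 3 + m ≤ 2
  3+m≰2 (s≤s (s≤s ()))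

longClause-assign : ∀ {m F} → HasLongClause (suc (suc m)) F → ∀ x →
  ¬ ¬ (∃[ ε ] HasLongClause (suc m) (assign x ε F))
longClause-assign {m} {F} (c , c∈F , long) x k = ¬¬-excluded-middle λ
  { (yes x,t∈) → k (false , shrink false (λ x,f∈ → noComplement x x,t∈ x,f∈))
  ; (no x,t∉)  → k (true , shrink true x,t∉) }
  where
  open LongClause long
  τ : Bool → Var → Bool
  τ ε _ = ε
  kept-var : ∀ {ε y} → y ∈ map var c → y ≢ x → y ∈ map var (filter (keep? (x ∷ []) (τ ε)) c)
  kept-var {ε} y∈ y≢x with ∈-map⁻ var y∈
  ... | l , l∈ , refl =
    ∈-map⁺ var (∈-filter⁺ (keep? (x ∷ []) (τ ε)) l∈ (keep-untouched {x ∷ []} {τ ε} l (∉-single y≢x)))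
  shrink : ∀ ε → (x , ε) ∉ c → HasLongClause (suc m) (assign x ε F)
  shrink ε x,ε∉ = filter (keep? (x ∷ []) (τ ε)) c ,
    ∈-restrict⁺ {x ∷ []} {τ ε} c∈F
      (anyB-false (All.tabulate λ {l} l∈ → litTrue-single-false {x} {ε} l λ { refl → x,ε∉ l∈ })) ,
    record
    { noComplement = λ y y,t∈ y,f∈ → noComplement y (proj₁ (∈-filter⁻ (keep? (x ∷ []) (τ ε)) y,t∈))
                                                     (proj₁ (∈-filter⁻ (keep? (x ∷ []) (τ ε)) y,f∈))
    ; vars         = without _≟ₙ_ x vars
    ; vars-unique  = Unique-without _≟ₙ_ vars-unique
    ; vars-many    = ≤-pred (≤-trans vars-many (length≤1+length-without _≟ₙ_ x vars-unique))
    ; vars⊆        = λ y∈ → let y∈vars , y≢x = ∈-without⁻ _≟ₙ_ {xs = vars} y∈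
                            in kept-var (vars⊆ y∈vars) y≢x
    }

longClause-component : ∀ {m F} → HasLongClause (suc m) F →
  ¬ ¬ (∃[ F' ] (IsComponent F F' × HasLongClause (suc m) F'))
longClause-component (c , c∈F , long) k = ¬¬-component c∈F λ (F' , F'-component , closed) →
  k (F' , F'-component , c , closed c∈F (here c∈F) , long)

open DepthLowerBound Krom HasLongClause longClause∉Krom longClause-assign longClause-component
  renaming (¬DepthLE to longClause⇒¬KromDepthLE)

uniformClause : Bool → ℕ → Clause
uniformClause p n = map (_, p) (downFrom n)

vars-uniformClause : ∀ p n → map var (uniformClause p n) ≡ downFrom n
vars-uniformClause p n = trans (sym (map-∘ (downFrom n))) (map-id (downFrom n))

longClauses : Bool → ℕ → CNF
longClauses p k = uniformClause p (3 + k) ∷ []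

longClauses-WF : ∀ p k → WF (longClauses p k)
longClauses-WF p k =
  distinctVars⇒WFClause (subst Unique (sym (vars-uniformClause p (3 + k))) (Unique.downFrom⁺ (3 + k))) ∷ []

longClauses-¬KromDepthLE : ∀ p k → ¬ DepthLE Krom k (longClauses p k)
longClauses-¬KromDepthLE p k d = longClause⇒¬KromDepthLE d (uniformClause p (3 + k) , here refl , record
  { noComplement = proj₂ (All.lookup (longClauses-WF p k) (here refl))
  ; vars         = downFrom (3 + k)
  ; vars-unique  = Unique.downFrom⁺ (3 + k)
  ; vars-many    = ≤-reflexive (sym (length-downFrom (3 + k)))
  ; vars⊆        = subst (downFrom (3 + k) ⊆_) (sym (vars-uniformClause p (3 + k))) (λ i∈ → i∈)
  })

negativeLongClauses-Horn : ∀ k → Horn (longClauses false k)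
negativeLongClauses-Horn k = subst (λ ls → length ls ≤ 1) (sym (no-positive (3 + k))) z≤n ∷ []
  where
  no-positive : ∀ n → filter (λ l → positive l ≟ᵇ true) (uniformClause false n) ≡ []
  no-positive zero    = refl
  no-positive (suc n) = no-positive n

positiveLongClauses-dHorn : ∀ k → dHorn (longClauses true k)
positiveLongClauses-dHorn k = subst (λ ls → length ls ≤ 1) (sym (no-negative (3 + k))) z≤n ∷ []
  where
  no-negative : ∀ n → filter (λ l → negative l ≟ᵇ true) (uniformClause true n) ≡ []
  no-negative zero    = refl
  no-negative (suc n) = no-negative n

-- A clique of 2-clauses of one sign has unbounded Horn- or dHorn-depth

pairClause : Bool → Var → Var → Clause
pairClause p i j = (i , p) ∷ (j , p) ∷ []

clique : Bool → ℕ → CNF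
clique p zero    = []
clique p (suc n) = map (λ i → pairClause p i n) (downFrom n) ++ clique p n

cliques : Bool → ℕ → CNF
cliques p k = clique p (2 + k)

∈-clique⁺ : ∀ {p i j n} → i < j → j < n → pairClause p i j ∈ clique p n
∈-clique⁺ {p} {i} {j} {suc n} i<j (s≤s j≤n) with j ≟ₙ n
... | yes refl = ∈-++⁺ˡ (∈-map⁺ (λ i → pairClause p i n) (∈-downFrom⁺ i<j))
... | no j≢n   = ∈-++⁺ʳ _ (∈-clique⁺ i<j (≤∧≢⇒< j≤n j≢n))

clique-All : ∀ {P : Clause → Set} {p} → (∀ {i j} → i < j → P (pairClause p i j)) →
  ∀ n → All P (clique p n)
clique-All P-pair zero    = []
clique-All P-pair (suc n) =
  All.++⁺ (All.map⁺ (All.tabulate (λ i∈ → P-pair (∈-downFrom⁻ i∈)))) (clique-All P-pair n)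

record Clique (p : Bool) (m : ℕ) (F : CNF) : Set where
  field
    vertices        : List Var
    vertices-unique : Unique vertices
    vertices-many   : suc m ≤ length vertices
    edge∈           : ∀ {i j} → i ∈ vertices → j ∈ vertices → i < j → pairClause p i j ∈ F

some-edge : ∀ {p m F} (K : Clique p (suc m) F) → let open Clique K in
  ∃[ i ] ∃[ j ] (i ∈ vertices × j ∈ vertices × i < j)
some-edge K = ordered-pair vertices-unique (≤-trans (s≤s (s≤s z≤n)) vertices-many)
  where open Clique K

edges-linked : ∀ {p m F} (K : Clique p m F) → let open Clique K in
  ∀ {u v i j} → u ∈ vertices → v ∈ vertices → u < v → i ∈ vertices → j ∈ vertices → i < j →
  Linked F (pairClause p u v) (pairClause p i j)
edges-linked {p} {F = F} K {u} {v} {i} {j} u∈ v∈ u<v i∈ j∈ i<j = via (<-cmp u i)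
  where
  open Clique K
  start : Linked F (pairClause p u v) (pairClause p u v)
  start = here (edge∈ u∈ v∈ u<v)
  via : Tri (u < i) (u ≡ i) (i < u) → Linked F (pairClause p u v) (pairClause p i j)
  via (tri≈ _ refl _) = step start (edge∈ i∈ j∈ i<j) (u , here refl , here refl)
  via (tri< u<i _ _)  = step (step start (edge∈ u∈ i∈ u<i) (u , here refl , here refl))
                             (edge∈ i∈ j∈ i<j) (i , there (here refl) , here refl)
  via (tri> _ _ i<u)  = step (step start (edge∈ i∈ u∈ i<u) (u , here refl , there (here refl)))
                             (edge∈ i∈ j∈ i<j) (i , here refl , here refl)

module CliqueLowerBound (C : BaseClass) (p : Bool) (pair∉C : ∀ i j → ¬ ClauseIn C (pairClause p i j)) where

  clique∉C : ∀ {m F} → Clique p (suc m) F → ¬ ⟦ C ⟧ᶜ F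
  clique∉C K with some-edge K
  ... | i , j , i∈ , j∈ , i<j = ∉⟦⟧ᶜ C (Clique.edge∈ K i∈ j∈ i<j) (pair∉C i j)

  -- Either value works: the edges avoiding x are untouched.
  clique-assign : ∀ {m F} → Clique p (suc (suc m)) F → ∀ x → ¬ ¬ (∃[ ε ] Clique p (suc m) (assign x ε F))
  clique-assign K x k = k (true , record
    { vertices        = without _≟ₙ_ x vertices
    ; vertices-unique = Unique-without _≟ₙ_ vertices-unique
    ; vertices-many   = ≤-pred (≤-trans vertices-many (length≤1+length-without _≟ₙ_ x vertices-unique))
    ; edge∈           = λ i∈ j∈ i<j →
        let i∈vs , i≢x = ∈-without⁻ _≟ₙ_ {xs = vertices} i∈
            j∈vs , j≢x = ∈-without⁻ _≟ₙ_ {xs = vertices} j∈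
        in untouched-∈-restrict (edge∈ i∈vs j∈vs i<j) (∉-single i≢x ∷ ∉-single j≢x ∷ [])
    })
    where open Clique K

  clique-component : ∀ {m F} → Clique p (suc m) F → ¬ ¬ (∃[ F' ] (IsComponent F F' × Clique p (suc m) F'))
  clique-component K k with some-edge K
  ... | i , j , i∈ , j∈ , i<j = ¬¬-component (Clique.edge∈ K i∈ j∈ i<j) λ (F' , F'-component , closed) →
    k (F' , F'-component , record
      { vertices        = Clique.vertices K
      ; vertices-unique = Clique.vertices-unique K
      ; vertices-many   = Clique.vertices-many K
      ; edge∈           = λ u∈ v∈ u<v →
          closed (Clique.edge∈ K u∈ v∈ u<v) (edges-linked K i∈ j∈ i<j u∈ v∈ u<v)
      })

  open DepthLowerBound ⟦ C ⟧ᶜ (Clique p) clique∉C clique-assign clique-component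

  cliques-¬DepthLE : ∀ k → ¬ DepthLE ⟦ C ⟧ᶜ k (cliques p k)
  cliques-¬DepthLE k d = ¬DepthLE d record
    { vertices        = downFrom (2 + k)
    ; vertices-unique = Unique.downFrom⁺ (2 + k)
    ; vertices-many   = ≤-reflexive (sym (length-downFrom (2 + k)))
    ; edge∈           = λ _ j∈ i<j → ∈-clique⁺ i<j (∈-downFrom⁻ j∈)
    }

positivePair∉Horn : ∀ i j → ¬ ClauseIn horn (pairClause true i j)
positivePair∉Horn i j (s≤s ())

negativePair∉dHorn : ∀ i j → ¬ ClauseIn dhorn (pairClause false i j)
negativePair∉dHorn i j (s≤s ())

module PositiveCliques = CliqueLowerBound horn  true  positivePair∉Horn
module NegativeCliques = CliqueLowerBound dhorn false negativePair∉dHorn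

cliques-WF : ∀ p k → WF (cliques p k)
cliques-WF p k = clique-All (λ i<j → distinctVars⇒WFClause ((<⇒≢ i<j ∷ []) ∷ [] ∷ [])) (2 + k)

cliques-Krom : ∀ p k → Krom (cliques p k)
cliques-Krom p k = clique-All (λ _ → s≤s (s≤s z≤n)) (2 + k)

positiveCliques-dHorn : ∀ k → dHorn (cliques true k)
positiveCliques-dHorn k = clique-All (λ _ → z≤n) (2 + k)

negativeCliques-Horn : ∀ k → Horn (cliques false k)
negativeCliques-Horn k = clique-All (λ _ → z≤n) (2 + k)

-- Disjoint gadgets: bounded depth, unbounded size

gadgetVar : ℕ → ℕ → Var
gadgetVar i j = j + i * 4

gadgetVar-block : ∀ i {j} → j < 4 → gadgetVar i j / 4 ≡ i
gadgetVar-block i {j} j<4 = begin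
  (j + i * 4) / 4   ≡⟨ +-distrib-/-∣ʳ j (divides i refl) ⟩
  j / 4 + i * 4 / 4 ≡⟨ cong₂ _+_ (m<n⇒m/n≡0 j<4) (m*n/n≡m i 4) ⟩
  i                 ∎
  where open ≡-Reasoning

gadget : ℕ → Clause
gadget i = (gadgetVar i 0 , true) ∷ (gadgetVar i 1 , true)
          ∷ (gadgetVar i 2 , false) ∷ (gadgetVar i 3 , false) ∷ []

gadget∉ : ∀ C i → ¬ ClauseIn C (gadget i)
gadget∉ horn  i (s≤s ())
gadget∉ dhorn i (s≤s ())
gadget∉ krom  i (s≤s (s≤s ()))

gadget-distinctVars : ∀ i → Unique (map var (gadget i))
gadget-distinctVars i = Unique.map⁺ (+-cancelʳ-≡ (i * 4) _ _) (Unique.upTo⁺ 4)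

occursIn-gadget : ∀ i {x} → x occursIn gadget i → x / 4 ≡ i
occursIn-gadget i (here refl)                         = gadgetVar-block i (s≤s z≤n)
occursIn-gadget i (there (here refl))                 = gadgetVar-block i (s≤s (s≤s z≤n))
occursIn-gadget i (there (there (here refl)))         = gadgetVar-block i (s≤s (s≤s (s≤s z≤n)))
occursIn-gadget i (there (there (there (here refl)))) = gadgetVar-block i (s≤s (s≤s (s≤s (s≤s z≤n))))

gadget-injective : ∀ i j → gadget i ≡ gadget j → i ≡ j
gadget-injective i j i≡j =
  trans (sym (gadgetVar-block i (s≤s z≤n))) (occursIn-gadget j (subst (gadgetVar i 0 occursIn_) i≡j (here refl)))

gadgets : ℕ → CNF
gadgets k = map gadget (downFrom (2 + k))

gadgets-WF : ∀ k → WF (gadgets k)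
gadgets-WF k =
  All.map⁺ (All.tabulate {xs = downFrom (2 + k)} (λ {i} _ → distinctVars⇒WFClause (gadget-distinctVars i)))

gadgets-varDisjoint : ∀ k → VarDisjoint (gadgets k)
gadgets-varDisjoint k {c} {d} c∈ d∈ (x , x∈c , x∈d)
  with ∈-map⁻ gadget {xs = downFrom (2 + k)} c∈ | ∈-map⁻ gadget {xs = downFrom (2 + k)} d∈
... | i , _ , refl | j , _ , refl = cong gadget (trans (sym (occursIn-gadget i x∈c)) (occursIn-gadget j x∈d))

gadgets-disconnected : ∀ k → ¬ Connected (gadgets k)
gadgets-disconnected k connected = 1+n≢n (sym (gadget-injective k (suc k) (Linked⇒≡ (gadgets-varDisjoint k)
  (here refl) (connected (gadget (suc k)) (gadget k) (here refl) (there (here refl))))))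

gadgets-depth≤4 : ∀ C k → DepthLE ⟦ C ⟧ᶜ 4 (gadgets k)
gadgets-depth≤4 C k = comps (∉⟦⟧ᶜ C (here refl) (gadget∉ C (suc k))) (gadgets-disconnected k) component-depth
  where
  component-depth : ∀ F' → IsComponent (gadgets k) F' → DepthLE ⟦ C ⟧ᶜ 4 F'
  component-depth F' (c , c∈ , F'≈) with ∈-map⁻ gadget {xs = downFrom (2 + k)} c∈
  ... | i , _ , refl = subst (λ 𝒞 → DepthLE 𝒞 4 F') (sym (⟦⟧ᶜ≡All C))
    (depth≤length-copies (ClauseIn? C) (ClauseIn-[] C) (gadget i) (gadget-distinctVars i)
      (Equivalence.from (F'≈ (gadget i)) (c∈ , here c∈) ,
       All.tabulate λ d∈ → Linked⇒≡ (gadgets-varDisjoint k) c∈ (proj₂ (Equivalence.to (F'≈ _) d∈))))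

gadgets-¬size : ∀ C C' k → ¬ size (⟦ C ⟧ᶜ ∪ᶜ ⟦ C' ⟧ᶜ) k (gadgets k)
gadgets-¬size C C' k (B , |B|≤k , _ , B-backdoor) = pigeonhole (map (_/ 4) B) |blocks|<2+k every-block-hit
  where
  |blocks|<2+k : length (map (_/ 4) B) < 2 + k
  |blocks|<2+k = s≤s (≤-trans (≤-reflexive (length-map _ B)) (≤-trans |B|≤k (n≤1+n k)))
  every-block-hit : ∀ i → i < 2 + k → i ∈ map (_/ 4) B
  every-block-hit i i<2+k with i ∈? map (_/ 4) B
  ... | yes hit = hit
  ... | no miss = ⊥-elim (survivor-∉ survivor (B-backdoor (λ _ → false)))
    where
    untouched : Untouched B (gadget i)
    untouched = All.tabulate λ {l} l∈ var∈B →
      miss (subst (_∈ map (_/ 4) B) (occursIn-gadget i (Any.map (λ { refl → refl }) l∈))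
                  (∈-map⁺ (_/ 4) var∈B))
    survivor : gadget i ∈ restrict B (λ _ → false) (gadgets k)
    survivor = untouched-∈-restrict (∈-map⁺ gadget (∈-downFrom⁺ i<2+k)) untouched
    survivor-∉ : ∀ {F} → gadget i ∈ F → ¬ (⟦ C ⟧ᶜ F ⊎ ⟦ C' ⟧ᶜ F)
    survivor-∉ i∈F (inj₁ ∈C)  = ∉⟦⟧ᶜ C i∈F (gadget∉ C i) ∈C
    survivor-∉ i∈F (inj₂ ∈C') = ∉⟦⟧ᶜ C' i∈F (gadget∉ C' i) ∈C'

Range : (ℕ → CNF) → Class
Range fam F = ∃[ n ] F ≡ fam n

¬Dominates-by-family : ∀ (p q : Param) (fam : ℕ → CNF) → (∀ n → WF (fam n)) →
  Bounded q (Range fam) → (∀ k → ¬ p k (fam k)) → ¬ Dominates p q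
¬Dominates-by-family p q fam wf q-bounded p-unbounded dom with dom (Range fam) q-bounded
... | k , p≤k = p-unbounded k (p≤k (fam k) (wf k) (k , refl))

¬size-dominates-depth : ∀ C C' → ¬ Dominates (size (⟦ C ⟧ᶜ ∪ᶜ ⟦ C' ⟧ᶜ)) (depth ⟦ C ⟧ᶜ)
¬size-dominates-depth C C' = ¬Dominates-by-family _ _ gadgets gadgets-WF
  (4 , λ { _ _ (k , refl) → gadgets-depth≤4 C k }) (gadgets-¬size C C')

¬depth-dominates-size-by : ∀ C C' (fam : ℕ → CNF) → (∀ k → WF (fam k)) → (∀ k → ⟦ C' ⟧ᶜ (fam k)) →
  (∀ k → ¬ DepthLE ⟦ C ⟧ᶜ k (fam k)) → ¬ Dominates (depth ⟦ C ⟧ᶜ) (size (⟦ C ⟧ᶜ ∪ᶜ ⟦ C' ⟧ᶜ))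
¬depth-dominates-size-by C C' fam fam-WF fam∈C' =
  ¬Dominates-by-family _ _ fam fam-WF (0 , λ { _ _ (k , refl) → size-zero C C' (fam∈C' k) })

¬depth-dominates-size : ∀ C C' → C ≢ C' → ¬ Dominates (depth ⟦ C ⟧ᶜ) (size (⟦ C ⟧ᶜ ∪ᶜ ⟦ C' ⟧ᶜ))
¬depth-dominates-size horn dhorn _ = ¬depth-dominates-size-by horn dhorn
  (cliques true) (cliques-WF true) positiveCliques-dHorn PositiveCliques.cliques-¬DepthLE
¬depth-dominates-size horn krom _ = ¬depth-dominates-size-by horn krom
  (cliques true) (cliques-WF true) (cliques-Krom true) PositiveCliques.cliques-¬DepthLE
¬depth-dominates-size dhorn horn _ = ¬depth-dominates-size-by dhorn horn
  (cliques false) (cliques-WF false) negativeCliques-Horn NegativeCliques.cliques-¬DepthLE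
¬depth-dominates-size dhorn krom _ = ¬depth-dominates-size-by dhorn krom
  (cliques false) (cliques-WF false) (cliques-Krom false) NegativeCliques.cliques-¬DepthLE
¬depth-dominates-size krom horn _ = ¬depth-dominates-size-by krom horn
  (longClauses false) (longClauses-WF false) negativeLongClauses-Horn (longClauses-¬KromDepthLE false)
¬depth-dominates-size krom dhorn _ = ¬depth-dominates-size-by krom dhorn
  (longClauses true) (longClauses-WF true) positiveLongClauses-dHorn (longClauses-¬KromDepthLE true)
¬depth-dominates-size horn  horn  C≢C = contradiction refl C≢C
¬depth-dominates-size dhorn dhorn C≢C = contradiction refl C≢C
¬depth-dominates-size krom  krom  C≢C = contradiction refl C≢C

mainTheorem16 : (C C' : BaseClass) → C ≢ C' →
    DominationOrthogonal (size (⟦ C ⟧ᶜ ∪ᶜ ⟦ C' ⟧ᶜ)) (depth ⟦ C ⟧ᶜ)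
mainTheorem16 C C' C≢C' = ¬size-dominates-depth C C' , ¬depth-dominates-size C C' C≢C'
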